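{- Let $k\ge 2$, let $J\subseteq C(n,k)$ be a realizable $k$-set, let $\rho_s$ be an admissible $J_s$-order, and let $\rho_F$ be a total order on $J_F$ arising from a maximal chain in $(\overline{\mathrm{Paths}}_{k-1}(\emptyset,J),\le_{\mathrm{MS}})$. Then the concatenated total order $\rho_s\rho_F$ on $J_s\cup J_F$ (all of $J_s$ in order $\rho_s$, then all of $J_F$ in order $\rho_F$) is an admissible $(J_s\cup J_F)$-order; in particular it lies in $\mathcal A_{S\le F}=\{\rho\text{ admissible }(J_s\cup J_F)\text{ -order}: s\le_\rho f\text{ for all }s\in J_s,f\in J_F\}$.
   Context: $C(n,m)$: $m$-subsets of $\{1,\dots,n\}$, lexicographic order on increasing sequences, antilexicographic = reverse. For $X\in C(n,m+1)$, $P_X=\{Y\in C(n,m):Y\subset X\}$ with lexicographic order; prefix/suffix = initial/final segment (possibly empty or all). For $A\subseteq C(n,m)$: $A_p$ (resp. $A_s$) = $\{X\in C(n,m+1):P_X\cap A$ a nonempty prefix (resp. suffix) of $P_X$, $\ne P_X\}$, $A_F=\{X:P_X\subseteq A\}$; $A$ is realizable if each $P_X\cap A$ is a prefix or suffix of $P_X$. An admissible $A$-order is a total order on $A$ inducing antilexicographic order on $P_X\cap A$ for $X\in A_s$, lexicographic on $P_X\cap A$ for $X\in A_p$, and lex or antilex on $P_X$ for $X\in A_F$; its inversion set is $A_s\cup\{X\in A_F:\text{antilex on }P_X\}$. Elementary equivalence: swap adjacent elements not in a common packet; $\overline{\mathrm{Paths}}_{k-1}(\emptyset,J)$ is the set of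 equivalence classes of admissible $J$-orders. Packet flip $p_X(r)$ ($X\in J_F$, $P_X$ contiguous in a representative): reverse that block. A maximal chain is a sequence of classes $r_0,\dots,r_m$ with $\mathrm{Inv}(r_0)=J_s$, $\mathrm{Inv}(r_m)=J_s\cup J_F$, and $r_j=p_{X_j}(r_{j-1})$ with $X_j\notin\mathrm{Inv}(r_{j-1})$; then $X_1,\dots,X_m$ enumerate $J_F$, and the associated order on $J_F$ is $X_1<\dots<X_m$. -}

module Defs where

open import Level using (0ℓ)
open import Data.Nat using (ℕ; suc; _<_; _≤_)
open import Data.List using (List; []; _∷_; _++_; reverse; length)
open import Data.List.Membership.Propositional using (_∈_)
open import Data.List.Relation.Unary.All using (All)
open import Data.List.Relation.Unary.AllPairs using (AllPairs)
open import Data.List.Relation.Unary.Unique.Propositional using (Unique)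
open import Data.Product using (_×_; Σ; ∃; ∃-syntax; _,_)
open import Data.Sum using (_⊎_)
open import Relation.Nullary using (¬_)
open import Relation.Binary.PropositionalEquality using (_≡_)
open import Relation.Binary.Construct.Closure.ReflexiveTransitive using (Star)

-- Subsets of {1,…,n} are encoded as strictly increasing lists of naturals.

Sub : Set
Sub = List ℕ

SubPred : Set₁
SubPred = Sub → Set

CS : ℕ → ℕ → Sub → Set
CS n m x = AllPairs _<_ x × All (λ i → 1 ≤ i × i ≤ n) x × length x ≡ m

_⊆ₛ_ : Sub → Sub → Set
y ⊆ₛ x = ∀ {i} → i ∈ y → i ∈ x

data _<lex_ : Sub → Sub → Set where
  base  : ∀ {y ys} → [] <lex (y ∷ ys)
  this  : ∀ {x y xs ys} → x < y → (x ∷ xs) <lex (y ∷ ys)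
  next  : ∀ {x xs ys} → xs <lex ys → (x ∷ xs) <lex (x ∷ ys)

-- Packets.  Y ∈ P_X  (for X ∈ C(n,m+1), Y ∈ C(n,m), Y ⊂ X)

InP : ℕ → ℕ → Sub → Sub → Set
InP n m X Y = CS n m Y × Y ⊆ₛ X

PrefixIn : ℕ → ℕ → SubPred → Sub → Set
PrefixIn n m A X = ∀ Y Z → InP n m X Y → InP n m X Z → Z <lex Y → A Y → A Z

SuffixIn : ℕ → ℕ → SubPred → Sub → Set
SuffixIn n m A X = ∀ Y Z → InP n m X Y → InP n m X Z → Y <lex Z → A Y → A Z

NonEmptyIn : ℕ → ℕ → SubPred → Sub → Set
NonEmptyIn n m A X = ∃[ Y ] (InP n m X Y × A Y)

NotFullIn : ℕ → ℕ → SubPred → Sub → Set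
NotFullIn n m A X = ∃[ Y ] (InP n m X Y × ¬ A Y)

Ap : ℕ → ℕ → SubPred → SubPred
Ap n m A X = CS n (suc m) X × NonEmptyIn n m A X × NotFullIn n m A X × PrefixIn n m A X

As : ℕ → ℕ → SubPred → SubPred
As n m A X = CS n (suc m) X × NonEmptyIn n m A X × NotFullIn n m A X × SuffixIn n m A X

AF : ℕ → ℕ → SubPred → SubPred
AF n m A X = CS n (suc m) X × (∀ Y → InP n m X Y → A Y)

Realizable : ℕ → ℕ → SubPred → Set
Realizable n m A = ∀ X → CS n (suc m) X → PrefixIn n m A X ⊎ SuffixIn n m A X

-- Total orders on a finite set A, encoded as duplicate-free lists
-- enumerating exactly A (first = smallest).

TotalOrderOn : SubPred → List Sub → Set
TotalOrderOn A L = Unique L × (∀ y → (y ∈ L → A y) × (A y → y ∈ L))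

Before : List Sub → Sub → Sub → Set
Before L y z = ∃[ pre ] ∃[ post ] (L ≡ pre ++ (y ∷ post) × z ∈ post)

InducesLex : ℕ → ℕ → SubPred → List Sub → Sub → Set
InducesLex n m A L X = ∀ Y Z → InP n m X Y → A Y → InP n m X Z → A Z →
                         Y <lex Z → Before L Y Z

InducesAntilex : ℕ → ℕ → SubPred → List Sub → Sub → Set
InducesAntilex n m A L X = ∀ Y Z → InP n m X Y → A Y → InP n m X Z → A Z →
                             Y <lex Z → Before L Z Y

Admissible : ℕ → ℕ → SubPred → List Sub → Set
Admissible n m A L =
  TotalOrderOn A L ×
  (∀ X → As n m A X → InducesAntilex n m A L X) ×
  (∀ X → Ap n m A X → InducesLex n m A L X) ×
  (∀ X → AF n m A X → InducesLex n m A L X ⊎ InducesAntilex n m A L X)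

Inv : ℕ → ℕ → SubPred → List Sub → SubPred
Inv n m A L X = As n m A X ⊎ (AF n m A X × InducesAntilex n m A L X)

_≐_ : SubPred → SubPred → Set
P ≐ Q = ∀ X → (P X → Q X) × (Q X → P X)

_∪_ : SubPred → SubPred → SubPred
(P ∪ Q) X = P X ⊎ Q X

CommonPacket : ℕ → ℕ → Sub → Sub → Set
CommonPacket n m a b = ∃[ X ] (CS n (suc m) X × InP n m X a × InP n m X b)

data ElemSwap (n m : ℕ) : List Sub → List Sub → Set where
  swap : ∀ pre a b post → ¬ CommonPacket n m a b →
         ElemSwap n m (pre ++ (a ∷ b ∷ post)) (pre ++ (b ∷ a ∷ post))

-- elementary equivalence (reflexive-transitive closure; ElemSwap is symmetric)
Equiv : ℕ → ℕ → List Sub → List Sub → Set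
Equiv n m = Star (ElemSwap n m)

Flip : ℕ → ℕ → Sub → List Sub → List Sub → Set
Flip n m X L L' = ∃[ pre ] ∃[ blk ] ∃[ post ]
  ( L ≡ pre ++ (blk ++ post)
  × (∀ Y → (Y ∈ blk → InP n m X Y) × (InP n m X Y → Y ∈ blk))
  × L' ≡ pre ++ (reverse blk ++ post))

-- Maximal chains in Paths_{k-1}(∅,J)  (J ⊆ C(n,k), classes of admissible
-- J-orders represented by representatives).

FlipStep : ℕ → ℕ → SubPred → Sub → List Sub → List Sub → Set
FlipStep n k J X r r' =
  AF n k J X × ¬ Inv n k J r X × Admissible n k J r' ×
  ∃[ q ] ∃[ q' ] (Equiv n k r q × Flip n k X q q' × Equiv n k q' r')

data FlipSteps (n k : ℕ) (J : SubPred) : List Sub → List Sub → List Sub → Set where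
  done : ∀ {r} → FlipSteps n k J r [] r
  step : ∀ {r r' r'' X Xs} → FlipStep n k J X r r' →
         FlipSteps n k J r' Xs r'' → FlipSteps n k J r (X ∷ Xs) r''

MaxChainOrder : ℕ → ℕ → SubPred → List Sub → Set
MaxChainOrder n k J ρF = ∃[ r₀ ] ∃[ rₘ ]
  ( Admissible n k J r₀
  × Inv n k J r₀ ≐ As n k J
  × Inv n k J rₘ ≐ (As n k J ∪ AF n k J)
  × FlipSteps n k J r₀ ρF rₘ)

Mem : List Sub → SubPred
Mem J y = y ∈ J

{-# OPTIONS --safe #-}
-- Admissibility is checked on the packet P_Z of each Z ∈ C(n, k+2), whose members are the
-- X v = Z ∖ {v}.  Inside P_Z, J_s and J_F are separated: according as X (max Z) lies in
-- J_s ∪ J_F or not, every J_s-member is lexicographically below or above every J_F-member, so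
-- P_Z ∩ J_s inherits the prefix/suffix shape of P_Z ∩ (J_s ∪ J_F) and putting J_s first is
-- consistent with the required orientation.  The chain order ρF is read off the admissible
-- orders along the chain: just after X is flipped, exactly the packets up to X in ρF are
-- reversed, so u precedes w in ρF unless some admissible J-order is lexicographic on P_u and
-- antilexicographic on P_w.  For a < b < c the sets Z ∖ {a,b}, Z ∖ {a,c}, Z ∖ {b,c} each lie
-- in two of the packets of X a, X b, X c, and the orientations lex-antilex-lex and
-- antilex-lex-antilex would order them cyclically.  Hence ρF is monotone on P_Z ∩ J_F, in the
-- direction forced by any J_p- or J_s-packet of P_Z.
module Submission where

open import Defs
open import Data.Nat using (ℕ; suc; _<_; _≤_; _≟_; _≤?_; z≤n; s≤s)
open import Data.Nat.Properties
  using (<-irrefl; <-trans; <-asym; <-cmp; ≤-trans; ≤-refl; n≤1+n; suc-injective; <⇒≢; >⇒≢; <⇒≤;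
         ≤∧≢⇒<; <-≤-trans; ≤-<-trans; ≰⇒>)
open import Data.List using (List; []; _∷_; _++_; reverse; length; [_])
open import Data.List.Properties using (unfold-reverse; ≡-dec)
open import Data.List.Membership.Propositional using (_∈_; _∉_; find)
open import Data.List.Membership.Propositional.Properties using (∈-++⁺ˡ; ∈-++⁺ʳ; ∈-++⁻; ∈-∃++)
open import Data.List.Relation.Unary.Any using (here; there)
open import Data.List.Relation.Unary.Any.Properties using (reverse⁺)
open import Data.List.Relation.Unary.All as All using (All; []; _∷_; all?)
open import Data.List.Relation.Unary.All.Properties using (¬All⇒Any¬)
open import Data.List.Relation.Unary.AllPairs using (AllPairs; []; _∷_)
open import Data.List.Relation.Unary.Unique.Propositional using (Unique)
import Data.List.Relation.Unary.Unique.Propositional.Properties as Unique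
open import Data.List.Relation.Binary.Permutation.Propositional
  using (_↭_; ↭-trans; ↭-swap; ↭-refl; ↭⇒↭ₛ)
open import Data.List.Relation.Binary.Permutation.Propositional.Properties using (++⁺ˡ)
import Data.List.Relation.Binary.Permutation.Setoid.Properties as PermutationSetoid
open import Data.Product as Prod using (_×_; ∃-syntax; _,_; proj₁; proj₂)
open import Data.Sum as Sum using (_⊎_; inj₁; inj₂; [_,_]′)
open import Data.Empty using (⊥-elim)
open import Relation.Nullary using (¬_; Dec; yes; no)
open import Relation.Nullary.Decidable using (_⊎-dec_)
open import Relation.Binary.PropositionalEquality
  using (_≡_; _≢_; refl; sym; trans; cong; subst; subst₂; setoid)
open import Relation.Binary using (tri<; tri≈; tri>)
open import Relation.Binary.Construct.Closure.ReflexiveTransitive using (ε; _◅_)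
open import Function using (_∘_; flip)
open import Relation.Unary using (∅)

module _ {A : Set} where

  data Precedes : List A → A → A → Set where
    here  : ∀ {a b xs} → b ∈ xs → Precedes (a ∷ xs) a b
    there : ∀ {a b x xs} → Precedes xs a b → Precedes (x ∷ xs) a b

  private variable
    a b c : A
    xs ys : List A

  precedes-∈ˡ : Precedes xs a b → a ∈ xs
  precedes-∈ˡ (here _)  = here refl
  precedes-∈ˡ (there p) = there (precedes-∈ˡ p)

  precedes-∈ʳ : Precedes xs a b → b ∈ xs
  precedes-∈ʳ (here b∈)  = there b∈
  precedes-∈ʳ (there p) = there (precedes-∈ʳ p)

  precedes-irrefl : Unique xs → ¬ Precedes xs a a
  precedes-irrefl (a∉ ∷ _) (here a∈) = All.lookup a∉ a∈ refl
  precedes-irrefl (_ ∷ u)  (there p) = precedes-irrefl u p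

  precedes-trans : Unique xs → Precedes xs a b → Precedes xs b c → Precedes xs a c
  precedes-trans u       (here b∈) (here _)  = ⊥-elim (precedes-irrefl u (here b∈))
  precedes-trans u       (here _)  (there q) = here (precedes-∈ʳ q)
  precedes-trans u       (there p) (here _)  = ⊥-elim (precedes-irrefl u (here (precedes-∈ʳ p)))
  precedes-trans (_ ∷ u) (there p) (there q) = there (precedes-trans u p q)

  precedes-asym : Unique xs → Precedes xs a b → ¬ Precedes xs b a
  precedes-asym u p q = precedes-irrefl u (precedes-trans u p q)

  precedes-cycle : Unique xs → Precedes xs a b → Precedes xs b c → ¬ Precedes xs c a
  precedes-cycle u p q = precedes-asym u (precedes-trans u p q)

  precedes-total : a ∈ xs → b ∈ xs → a ≢ b → Precedes xs a b ⊎ Precedes xs b a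
  precedes-total (here refl) (here refl) a≢b = ⊥-elim (a≢b refl)
  precedes-total (here refl) (there b∈)  _   = inj₁ (here b∈)
  precedes-total (there a∈)  (here refl) _   = inj₂ (here a∈)
  precedes-total (there a∈)  (there b∈)  a≢b with precedes-total a∈ b∈ a≢b
  ... | inj₁ p = inj₁ (there p)
  ... | inj₂ p = inj₂ (there p)

  precedes-++⁺ˡ : ∀ ys → Precedes xs a b → Precedes (xs ++ ys) a b
  precedes-++⁺ˡ ys (here b∈)  = here (∈-++⁺ˡ b∈)
  precedes-++⁺ˡ ys (there p) = there (precedes-++⁺ˡ ys p)

  precedes-++⁺ʳ : ∀ xs → Precedes ys a b → Precedes (xs ++ ys) a b
  precedes-++⁺ʳ []       p = p
  precedes-++⁺ʳ (x ∷ xs) p = there (precedes-++⁺ʳ xs p)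

  precedes-++⁺ : ∀ xs → a ∈ xs → b ∈ ys → Precedes (xs ++ ys) a b
  precedes-++⁺ (x ∷ xs) (here refl) b∈ = here (∈-++⁺ʳ xs b∈)
  precedes-++⁺ (x ∷ xs) (there a∈)  b∈ = there (precedes-++⁺ xs a∈ b∈)

  precedes-++⁻ : ∀ xs → Precedes (xs ++ ys) a b →
                 Precedes xs a b ⊎ (a ∈ xs × b ∈ ys) ⊎ Precedes ys a b
  precedes-++⁻ []       p = inj₂ (inj₂ p)
  precedes-++⁻ (x ∷ xs) (here b∈) with ∈-++⁻ xs b∈
  ... | inj₁ b∈xs = inj₁ (here b∈xs)
  ... | inj₂ b∈ys = inj₂ (inj₁ (here refl , b∈ys))
  precedes-++⁻ (x ∷ xs) (there p) with precedes-++⁻ xs p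
  ... | inj₁ q               = inj₁ (there q)
  ... | inj₂ (inj₁ (a∈ , b∈)) = inj₂ (inj₁ (there a∈ , b∈))
  ... | inj₂ (inj₂ q)        = inj₂ (inj₂ q)

  precedes-reverse : Precedes xs a b → Precedes (reverse xs) b a
  precedes-reverse {x ∷ xs} (here b∈) rewrite unfold-reverse x xs =
    precedes-++⁺ (reverse xs) (reverse⁺ b∈) (here refl)
  precedes-reverse {x ∷ xs} (there p) rewrite unfold-reverse x xs =
    precedes-++⁺ˡ [ x ] (precedes-reverse p)

  precedes-reverse-outside : ∀ pre blk post → Precedes (pre ++ blk ++ post) a b →
    ¬ (a ∈ blk × b ∈ blk) → Precedes (pre ++ reverse blk ++ post) a b
  precedes-reverse-outside pre blk post p not-both with precedes-++⁻ pre p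
  ... | inj₁ q = precedes-++⁺ˡ _ q
  ... | inj₂ (inj₁ (a∈ , b∈)) = precedes-++⁺ pre a∈ (reverse-middle b∈)
    where
    reverse-middle : b ∈ blk ++ post → b ∈ reverse blk ++ post
    reverse-middle b∈ with ∈-++⁻ blk b∈
    ... | inj₁ b∈blk  = ∈-++⁺ˡ (reverse⁺ b∈blk)
    ... | inj₂ b∈post = ∈-++⁺ʳ (reverse blk) b∈post
  ... | inj₂ (inj₂ q) with precedes-++⁻ blk q
  ...   | inj₁ r = ⊥-elim (not-both (precedes-∈ˡ r , precedes-∈ʳ r))
  ...   | inj₂ (inj₁ (a∈ , b∈)) = precedes-++⁺ʳ pre (precedes-++⁺ (reverse blk) (reverse⁺ a∈) b∈)
  ...   | inj₂ (inj₂ r) = precedes-++⁺ʳ pre (precedes-++⁺ʳ (reverse blk) r)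

  precedes-reverse-inside : ∀ pre blk post → Unique (pre ++ blk ++ post) →
    Precedes (pre ++ blk ++ post) a b → a ∈ blk → b ∈ blk →
    Precedes (pre ++ reverse blk ++ post) b a
  precedes-reverse-inside pre blk post u p a∈ b∈ with precedes-++⁻ pre p
  ... | inj₁ q = ⊥-elim (precedes-irrefl u (precedes-++⁺ pre (precedes-∈ˡ q) (∈-++⁺ˡ a∈)))
  ... | inj₂ (inj₁ (a∈pre , _)) = ⊥-elim (precedes-irrefl u (precedes-++⁺ pre a∈pre (∈-++⁺ˡ a∈)))
  ... | inj₂ (inj₂ q) with precedes-++⁻ blk q
  ...   | inj₁ r = precedes-++⁺ʳ pre (precedes-++⁺ˡ post (precedes-reverse r))
  ...   | inj₂ (inj₁ (_ , b∈post)) =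
          ⊥-elim (precedes-irrefl u (precedes-++⁺ʳ pre (precedes-++⁺ blk b∈ b∈post)))
  ...   | inj₂ (inj₂ r) =
          ⊥-elim (precedes-irrefl u (precedes-++⁺ʳ pre (precedes-++⁺ blk a∈ (precedes-∈ˡ r))))

  Unique-resp-↭ : xs ↭ ys → Unique xs → Unique ys
  Unique-resp-↭ p = PermutationSetoid.Unique-resp-↭ (setoid A) (↭⇒↭ₛ p)

precedes⇒before : ∀ {xs : List Sub} {a b} → Precedes xs a b → Before xs a b
precedes⇒before (here b∈) = [] , _ , refl , b∈
precedes⇒before {x ∷ _} (there p) with pre , post , refl , b∈ ← precedes⇒before p =
  x ∷ pre , post , refl , b∈

before⇒precedes : ∀ {xs : List Sub} {a b} → Before xs a b → Precedes xs a b
before⇒precedes ([] , _ , refl , b∈)        = here b∈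
before⇒precedes (x ∷ pre , post , refl , b∈) = there (before⇒precedes (pre , post , refl , b∈))

Sorted : List ℕ → Set
Sorted = AllPairs _<_

delete : ℕ → List ℕ → List ℕ
delete v [] = []
delete v (x ∷ xs) with x ≟ v
... | yes _ = delete v xs
... | no _  = x ∷ delete v xs

delete-≡ : ∀ {v x} xs → x ≡ v → delete v (x ∷ xs) ≡ delete v xs
delete-≡ {v} {x} xs x≡v with x ≟ v
... | yes _   = refl
... | no x≢v = ⊥-elim (x≢v x≡v)

delete-≢ : ∀ {v x} xs → x ≢ v → delete v (x ∷ xs) ≡ x ∷ delete v xs
delete-≢ {v} {x} xs x≢v with x ≟ v
... | yes x≡v = ⊥-elim (x≢v x≡v)
... | no _    = refl

delete-∉ : ∀ {v} xs → v ∉ xs → delete v xs ≡ xs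
delete-∉ []       _   = refl
delete-∉ {v} (x ∷ xs) v∉ with x ≟ v
... | yes refl = ⊥-elim (v∉ (here refl))
... | no _     = cong (x ∷_) (delete-∉ xs (λ v∈ → v∉ (there v∈)))

∈-delete⁻ : ∀ {v y} xs → y ∈ delete v xs → y ∈ xs × y ≢ v
∈-delete⁻ {v} (x ∷ xs) y∈ with x ≟ v
∈-delete⁻ {v} (x ∷ xs) y∈          | yes _ = let y∈xs , y≢v = ∈-delete⁻ xs y∈ in there y∈xs , y≢v
∈-delete⁻ {v} (x ∷ xs) (here refl) | no x≢v = here refl , x≢v
∈-delete⁻ {v} (x ∷ xs) (there y∈)  | no _ = let y∈xs , y≢v = ∈-delete⁻ xs y∈ in there y∈xs , y≢v

∈-delete⁺ : ∀ {v y} xs → y ∈ xs → y ≢ v → y ∈ delete v xs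
∈-delete⁺ {v} (x ∷ xs) y∈ y≢v with x ≟ v
∈-delete⁺ {v} (x ∷ xs) (here refl) y≢v | yes x≡v = ⊥-elim (y≢v x≡v)
∈-delete⁺ {v} (x ∷ xs) (there y∈)  y≢v | yes _   = ∈-delete⁺ xs y∈ y≢v
∈-delete⁺ {v} (x ∷ xs) (here refl) y≢v | no _    = here refl
∈-delete⁺ {v} (x ∷ xs) (there y∈)  y≢v | no _    = there (∈-delete⁺ xs y∈ y≢v)

All-delete : ∀ {P : ℕ → Set} {v} xs → All P xs → All P (delete v xs)
All-delete []       []         = []
All-delete {v = v} (x ∷ xs) (px ∷ pxs) with x ≟ v
... | yes _ = All-delete xs pxs
... | no _  = px ∷ All-delete xs pxs

Sorted-delete : ∀ {v} xs → Sorted xs → Sorted (delete v xs)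
Sorted-delete []       []         = []
Sorted-delete {v} (x ∷ xs) (x<xs ∷ s) with x ≟ v
... | yes _ = Sorted-delete xs s
... | no _  = All-delete xs x<xs ∷ Sorted-delete xs s

sorted-head< : ∀ {x xs y} → Sorted (x ∷ xs) → y ∈ xs → x < y
sorted-head< (x<xs ∷ _) y∈ = All.lookup x<xs y∈

sorted-head∉ : ∀ {x xs} → Sorted (x ∷ xs) → x ∉ xs
sorted-head∉ s x∈ = <-irrefl refl (sorted-head< s x∈)

length-delete : ∀ {v} xs → Sorted xs → v ∈ xs → suc (length (delete v xs)) ≡ length xs
length-delete {v} (x ∷ xs) s (here refl)
  rewrite delete-≡ {v} {x} xs refl | delete-∉ xs (sorted-head∉ s) = refl
length-delete {v} (x ∷ xs) s@(_ ∷ s′) (there v∈)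
  rewrite delete-≢ {v} {x} xs (<⇒≢ (sorted-head< s v∈)) = cong suc (length-delete xs s′ v∈)

delete-comm : ∀ u v xs → delete u (delete v xs) ≡ delete v (delete u xs)
delete-comm u v [] = refl
delete-comm u v (x ∷ xs) with x ≟ v | x ≟ u
... | yes _   | yes _   = delete-comm u v xs
... | yes x≡v | no _    = trans (delete-comm u v xs) (sym (delete-≡ (delete u xs) x≡v))
... | no _    | yes x≡u = trans (delete-≡ (delete v xs) x≡u) (delete-comm u v xs)
... | no x≢v  | no x≢u  = trans (delete-≢ (delete v xs) x≢u)
                            (trans (cong (x ∷_) (delete-comm u v xs)) (sym (delete-≢ (delete u xs) x≢v)))

<lex-irrefl : ∀ {xs} → ¬ xs <lex xs
<lex-irrefl (this x<x) = <-irrefl refl x<x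
<lex-irrefl (next p)   = <lex-irrefl p

<lex-asym : ∀ {xs ys} → xs <lex ys → ¬ ys <lex xs
<lex-asym (this p) (this q) = <-asym p q
<lex-asym (this p) (next _) = <-irrefl refl p
<lex-asym (next _) (this q) = <-irrefl refl q
<lex-asym (next p) (next q) = <lex-asym p q

<lex⇒≢ : ∀ {xs ys} → xs <lex ys → xs ≢ ys
<lex⇒≢ p refl = <lex-irrefl p

delete-<lex : ∀ {u w} xs → Sorted xs → u ∈ xs → w ∈ xs → w < u → delete u xs <lex delete w xs
delete-<lex (x ∷ xs) s (here refl) (here refl) w<u = ⊥-elim (<-irrefl refl w<u)
delete-<lex (x ∷ xs) s (here refl) (there w∈) w<u = ⊥-elim (<-asym w<u (sorted-head< s w∈))
delete-<lex {u} {w} (x ∷ [])     s (there ()) (here refl) w<u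
delete-<lex {u} {w} (x ∷ y ∷ ys) s@(x<ys ∷ _) (there u∈) (here refl) w<u
  rewrite delete-≡ {w} {x} (y ∷ ys) refl | delete-∉ (y ∷ ys) (sorted-head∉ s)
        | delete-≢ {u} {x} (y ∷ ys) (<⇒≢ w<u) = this (All.lookup x<ys (here refl))
delete-<lex {u} {w} (x ∷ xs) s@(_ ∷ s′) (there u∈) (there w∈) w<u
  rewrite delete-≢ {u} {x} xs (<⇒≢ (sorted-head< s u∈)) | delete-≢ {w} {x} xs (<⇒≢ (sorted-head< s w∈))
  = next (delete-<lex xs s′ u∈ w∈ w<u)

⊆ₛ-tail : ∀ {x xs ys} → Sorted (x ∷ xs) → (x ∷ xs) ⊆ₛ (x ∷ ys) → xs ⊆ₛ ys
⊆ₛ-tail s sub y∈ with sub (there y∈)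
... | here refl = ⊥-elim (sorted-head∉ s y∈)
... | there y∈′ = y∈′

⊆ₛ-drop-head : ∀ {x xs y ys} → Sorted (x ∷ xs) → Sorted (y ∷ ys) →
               (x ∷ xs) ⊆ₛ (y ∷ ys) → x ∈ ys → (x ∷ xs) ⊆ₛ ys
⊆ₛ-drop-head sx sy sub x∈ (here refl) = x∈
⊆ₛ-drop-head sx sy sub x∈ (there z∈) with sub (there z∈)
... | here refl = ⊥-elim (<-asym (sorted-head< sx z∈) (sorted-head< sy x∈))
... | there z∈′ = z∈′

⊆ₛ-length≤ : ∀ xs ys → Sorted xs → Sorted ys → xs ⊆ₛ ys → length xs ≤ length ys
⊆ₛ-length≤ []       ys _ _ _ = z≤n
⊆ₛ-length≤ (x ∷ xs) [] _ _ sub with () ← sub (here refl)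
⊆ₛ-length≤ (x ∷ xs) (y ∷ ys) sx@(_ ∷ sx′) sy@(_ ∷ sy′) sub with sub (here refl)
... | here refl = s≤s (⊆ₛ-length≤ xs ys sx′ sy′ (⊆ₛ-tail sx sub))
... | there x∈  = ≤-trans (⊆ₛ-length≤ (x ∷ xs) ys sx sy′ (⊆ₛ-drop-head sx sy sub x∈)) (n≤1+n _)

⊆ₛ-length-≡⇒≡ : ∀ xs ys → Sorted xs → Sorted ys → xs ⊆ₛ ys → length xs ≡ length ys → xs ≡ ys
⊆ₛ-length-≡⇒≡ []       []       _ _ _ _ = refl
⊆ₛ-length-≡⇒≡ (x ∷ xs) [] _ _ sub _ with () ← sub (here refl)
⊆ₛ-length-≡⇒≡ (x ∷ xs) (y ∷ ys) sx@(_ ∷ sx′) sy@(_ ∷ sy′) sub eq with sub (here refl)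
... | here refl = cong (x ∷_) (⊆ₛ-length-≡⇒≡ xs ys sx′ sy′ (⊆ₛ-tail sx sub) (suc-injective eq))
... | there x∈  = ⊥-elim (<-irrefl eq (s≤s (⊆ₛ-length≤ (x ∷ xs) ys sx sy′ (⊆ₛ-drop-head sx sy sub x∈))))

⊆ₛ-one-shorter⇒delete : ∀ ys xs → Sorted ys → Sorted xs → ys ⊆ₛ xs → suc (length ys) ≡ length xs →
                         ∃[ v ] (v ∈ xs × ys ≡ delete v xs)
⊆ₛ-one-shorter⇒delete [] (x ∷ []) _ _ _ _ = x , here refl , sym (delete-≡ {x} {x} [] refl)
⊆ₛ-one-shorter⇒delete (y ∷ ys) (x ∷ xs) sy@(_ ∷ sy′) sx@(_ ∷ sx′) sub eq with sub (here refl)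
... | here refl =
  let v , v∈ , ys≡ = ⊆ₛ-one-shorter⇒delete ys xs sy′ sx′ (⊆ₛ-tail sy sub) (suc-injective eq)
  in v , there v∈ , trans (cong (y ∷_) ys≡) (sym (delete-≢ xs (<⇒≢ (sorted-head< sx v∈))))
... | there y∈ =
  x , here refl , trans (⊆ₛ-length-≡⇒≡ (y ∷ ys) xs sy sx′ (⊆ₛ-drop-head sy sx sub y∈) (suc-injective eq))
                        (sym (trans (delete-≡ xs refl) (delete-∉ xs (sorted-head∉ sx))))

module _ {n m : ℕ} where

  CS-delete : ∀ {X v} → CS n (suc m) X → v ∈ X → CS n m (delete v X)
  CS-delete {X} (s , bounds , len) v∈ =
    Sorted-delete X s , All-delete X bounds , suc-injective (trans (length-delete X s v∈) len)

  delete∈packet : ∀ {X v} → CS n (suc m) X → v ∈ X → InP n m X (delete v X)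
  delete∈packet {X} cs v∈ = CS-delete cs v∈ , λ i∈ → proj₁ (∈-delete⁻ X i∈)

  packet⇒delete : ∀ {X Y} → CS n (suc m) X → InP n m X Y → ∃[ v ] (v ∈ X × Y ≡ delete v X)
  packet⇒delete {X} {Y} (sX , _ , lenX) ((sY , _ , lenY) , Y⊆X) =
    ⊆ₛ-one-shorter⇒delete Y X sY sX Y⊆X (trans (cong suc lenY) (sym lenX))

  -- The union of two distinct members of P_X is X.
  packet-determined : ∀ {X X′ A B} → CS n (suc m) X → CS n (suc m) X′ →
    InP n m X A → InP n m X B → A ⊆ₛ X′ → B ⊆ₛ X′ → A ≢ B → X ≡ X′
  packet-determined {X} {X′} csX@(sX , _ , lenX) (sX′ , _ , lenX′) A∈ B∈ A⊆ B⊆ A≢B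
    with a , _ , refl ← packet⇒delete csX A∈ | b , _ , refl ← packet⇒delete csX B∈ =
    ⊆ₛ-length-≡⇒≡ X X′ sX sX′ X⊆X′ (trans lenX (sym lenX′))
    where
    X⊆X′ : X ⊆ₛ X′
    X⊆X′ {i} i∈ with i ≟ a
    ... | yes refl = B⊆ (∈-delete⁺ X i∈ (λ i≡b → A≢B (cong (λ v → delete v X) i≡b)))
    ... | no i≢a   = A⊆ (∈-delete⁺ X i∈ i≢a)

  As-AF-disjoint : ∀ {A X} → As n m A X → ¬ AF n m A X
  As-AF-disjoint (_ , _ , (Y , Y∈ , Y∉A) , _) (_ , full) = Y∉A (full Y Y∈)

  lex-antilex-exclusive : 1 ≤ m → ∀ {A X r} → AF n m A X → Unique r →
    InducesLex n m A r X → ¬ InducesAntilex n m A r X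
  lex-antilex-exclusive 1≤m {X = x₁ ∷ x₂ ∷ xs} (cs@(s , _) , full) u lex antilex =
    precedes-asym u (before⇒precedes (lex A B A∈ (full A A∈) B∈ (full B B∈) A<B))
                    (before⇒precedes (antilex A B A∈ (full A A∈) B∈ (full B B∈) A<B))
    where
    A = delete x₂ (x₁ ∷ x₂ ∷ xs)
    B = delete x₁ (x₁ ∷ x₂ ∷ xs)
    A∈ = delete∈packet cs (there (here refl))
    B∈ = delete∈packet cs (here refl)
    A<B = delete-<lex (x₁ ∷ x₂ ∷ xs) s (there (here refl)) (here refl) (sorted-head< s (here refl))
  lex-antilex-exclusive 1≤m {X = []} ((_ , _ , ()) , _)
  lex-antilex-exclusive (s≤s z≤n) {X = _ ∷ []} ((_ , _ , ()) , _)

module _ {n m : ℕ} where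

  CommonPacket-sym : ∀ {a b} → CommonPacket n m a b → CommonPacket n m b a
  CommonPacket-sym (X , csX , a∈ , b∈) = X , csX , b∈ , a∈

  equiv⇒↭ : ∀ {r q} → Equiv n m r q → r ↭ q
  equiv⇒↭ ε = ↭-refl
  equiv⇒↭ (swap pre a b post _ ◅ rest) = ↭-trans (++⁺ˡ pre (↭-swap a b ↭-refl)) (equiv⇒↭ rest)

  equiv-preserves-packet-order : ∀ {r q a b} → Equiv n m r q → CommonPacket n m a b → a ≢ b →
                                 Precedes r a b → Precedes q a b
  equiv-preserves-packet-order ε _ _ p = p
  equiv-preserves-packet-order (swap pre x y post x≁y ◅ rest) ab a≢b p =
    equiv-preserves-packet-order rest ab a≢b (precedes-reverse-outside pre (x ∷ y ∷ []) post p not-both)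
    where
    not-both : ¬ (_ ∈ x ∷ y ∷ [] × _ ∈ x ∷ y ∷ [])
    not-both (here refl         , here refl)         = a≢b refl
    not-both (here refl         , there (here refl)) = x≁y ab
    not-both (there (here refl) , here refl)         = x≁y (CommonPacket-sym ab)
    not-both (there (here refl) , there (here refl)) = a≢b refl

_≟ₛ_ : (X Y : Sub) → Dec (X ≡ Y)
_≟ₛ_ = ≡-dec _≟_

open import Data.List.Membership.DecPropositional _≟ₛ_ using (_∈?_)

module FlipChains (n k : ℕ) (J : SubPred) where

  Lex : List Sub → Sub → Set
  Lex r Y = InducesLex n k J r Y

  Antilex : List Sub → Sub → Set
  Antilex r Y = InducesAntilex n k J r Y

  Adm : List Sub → Set
  Adm = Admissible n k J

  admissible-unique : ∀ {r} → Adm r → Unique r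
  admissible-unique adm = proj₁ (proj₁ adm)

  private variable
    r r′ : List Sub
    X Y : Sub

  flipStep-preserves-order : ∀ {A B} → FlipStep n k J X r r′ → CS n (suc k) Y →
    InP n k Y A → InP n k Y B → A ≢ B → Y ≢ X → Precedes r A B → Precedes r′ A B
  flipStep-preserves-order {Y = Y}
    ((csX , _) , _ , _ , _ , _ , r~q , (pre , blk , post , refl , blk≐P , refl) , q′~r′) csY A∈ B∈ A≢B Y≢X p =
    equiv-preserves-packet-order q′~r′ AB A≢B
      (precedes-reverse-outside pre blk post (equiv-preserves-packet-order r~q AB A≢B p) not-both)
    where
    AB = Y , csY , A∈ , B∈
    not-both : ¬ (_ ∈ blk × _ ∈ blk)
    not-both (A∈blk , B∈blk) = Y≢X (sym (packet-determined csX csY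
      (proj₁ (blk≐P _) A∈blk) (proj₁ (blk≐P _) B∈blk) (proj₂ A∈) (proj₂ B∈) A≢B))

  flipStep-preserves-lex : FlipStep n k J X r r′ → AF n k J Y → Y ≢ X → Lex r Y → Lex r′ Y
  flipStep-preserves-lex fs (csY , _) Y≢X lex A B A∈ jA B∈ jB A<B = precedes⇒before
    (flipStep-preserves-order fs csY A∈ B∈ (<lex⇒≢ A<B) Y≢X (before⇒precedes (lex A B A∈ jA B∈ jB A<B)))

  flipStep-preserves-antilex : FlipStep n k J X r r′ → AF n k J Y → Y ≢ X → Antilex r Y → Antilex r′ Y
  flipStep-preserves-antilex fs (csY , _) Y≢X antilex A B A∈ jA B∈ jB A<B = precedes⇒before
    (flipStep-preserves-order fs csY B∈ A∈ (<lex⇒≢ A<B ∘ sym) Y≢X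
      (before⇒precedes (antilex A B A∈ jA B∈ jB A<B)))

  flipStep-reverses : FlipStep n k J X r r′ → Unique r → Lex r X → Antilex r′ X
  flipStep-reverses {X = X}
    ((csX , _) , _ , _ , _ , _ , r~q , (pre , blk , post , refl , blk≐P , refl) , q′~r′) u lex A B A∈ jA B∈ jB A<B =
    precedes⇒before (equiv-preserves-packet-order q′~r′ (X , csX , B∈ , A∈) (<lex⇒≢ A<B ∘ sym)
      (precedes-reverse-inside pre blk post (Unique-resp-↭ (equiv⇒↭ r~q) u)
        (equiv-preserves-packet-order r~q (X , csX , A∈ , B∈) (<lex⇒≢ A<B) (before⇒precedes (lex A B A∈ jA B∈ jB A<B)))
        (proj₂ (blk≐P A) A∈) (proj₂ (blk≐P B) B∈)))

  Oriented : SubPred → List Sub → Set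
  Oriented D r = Adm r × (∀ Y → AF n k J Y → (D Y → Antilex r Y) × (¬ D Y → Lex r Y))

  oriented-resp : ∀ {D D′} → (∀ {Y} → D Y → D′ Y) → (∀ {Y} → D′ Y → D Y) → Oriented D r → Oriented D′ r
  oriented-resp D⊆D′ D′⊆D (adm , or) =
    adm , λ Y afY → (proj₁ (or Y afY) ∘ D′⊆D) , (λ Y∉D′ → proj₂ (or Y afY) (Y∉D′ ∘ D⊆D′))

  flipStep-oriented : ∀ {D} → Oriented D r → FlipStep n k J X r r′ → ¬ D X × Oriented (D ∪ (_≡ X)) r′
  flipStep-oriented {r} {X} {D = D} (adm , or) fs@(afX , X∉Inv , adm′ , _) = X∉D , adm′ , or′
    where
    X∉D : ¬ D X
    X∉D X∈D = X∉Inv (inj₂ (afX , proj₁ (or X afX) X∈D))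
    or′ : ∀ Y → AF n k J Y → ((D ∪ (_≡ X)) Y → Antilex _ Y) × (¬ (D ∪ (_≡ X)) Y → Lex _ Y)
    or′ Y afY with Y ≟ₛ X
    ... | yes refl = (λ _ → flipStep-reverses fs (admissible-unique adm) (proj₂ (or X afX) X∉D)) ,
                     (λ Y∉ → ⊥-elim (Y∉ (inj₂ refl)))
    ... | no Y≢X   = (λ { (inj₁ Y∈D) → flipStep-preserves-antilex fs afY Y≢X (proj₁ (or Y afY) Y∈D)
                        ; (inj₂ Y≡X) → ⊥-elim (Y≢X Y≡X) }) ,
                     (λ Y∉ → flipStep-preserves-lex fs afY Y≢X (proj₂ (or Y afY) (Y∉ ∘ inj₁)))

  flipSteps-oriented : ∀ {D Xs} → Oriented D r → FlipSteps n k J r Xs r′ →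
                       All (¬_ ∘ D) Xs × Unique Xs × Oriented (D ∪ (_∈ Xs)) r′
  flipSteps-oriented or done = [] , [] , oriented-resp inj₁ (λ { (inj₁ Y∈D) → Y∈D ; (inj₂ ()) }) or
  flipSteps-oriented or (step fs rest) with flipStep-oriented or fs
  ... | X∉D , or′ with flipSteps-oriented or′ rest
  ...   | Xs∉ , uXs , or″ =
    X∉D ∷ All.map (_∘ inj₁) Xs∉ ,
    All.map (λ X∉ X≡Y → X∉ (inj₂ (sym X≡Y))) Xs∉ ∷ uXs ,
    oriented-resp (λ { (inj₁ (inj₁ Y∈D)) → inj₁ Y∈D ; (inj₁ (inj₂ refl)) → inj₂ (here refl)
                     ; (inj₂ Y∈Xs) → inj₂ (there Y∈Xs) })
                  (λ { (inj₁ Y∈D) → inj₁ (inj₁ Y∈D) ; (inj₂ (here refl)) → inj₁ (inj₂ refl)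
                     ; (inj₂ (there Y∈Xs)) → inj₂ Y∈Xs })
                  or″

  flipSteps-AF : ∀ {Xs} → FlipSteps n k J r Xs r′ → All (AF n k J) Xs
  flipSteps-AF done                = []
  flipSteps-AF (step (afX , _) rest) = afX ∷ flipSteps-AF rest

  flipSteps-++⁻ : ∀ pre {post} → FlipSteps n k J r (pre ++ post) r′ →
                  ∃[ r₁ ] (FlipSteps n k J r pre r₁ × FlipSteps n k J r₁ post r′)
  flipSteps-++⁻ []        steps         = _ , done , steps
  flipSteps-++⁻ (X ∷ pre) (step fs rest) =
    let r₁ , steps₁ , steps₂ = flipSteps-++⁻ pre rest in r₁ , step fs steps₁ , steps₂

  oriented-after : ∀ {Xs} → Oriented ∅ r → FlipSteps n k J r Xs r′ → X ∈ Xs →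
                   ∃[ r₁ ] Oriented (λ Y → Y ≡ X ⊎ Precedes Xs Y X) r₁
  oriented-after {X = X} or steps X∈ with pre , post , refl ← ∈-∃++ X∈
    with _ , steps-pre , step fs _ ← flipSteps-++⁻ pre steps =
    let u = proj₁ (proj₂ (flipSteps-oriented or steps))
        _ , or-pre = flipSteps-oriented or steps-pre
        _ , or₁    = flipStep-oriented (proj₂ or-pre) fs
    in _ , oriented-resp to (from u) or₁
    where
    to : ∀ {Y} → ((∅ ∪ (_∈ pre)) ∪ (_≡ X)) Y → Y ≡ X ⊎ Precedes (pre ++ X ∷ post) Y X
    to (inj₁ (inj₂ Y∈pre)) = inj₂ (precedes-++⁺ pre Y∈pre (here refl))
    to (inj₂ Y≡X)          = inj₁ Y≡X
    from : Unique (pre ++ X ∷ post) → ∀ {Y} → Y ≡ X ⊎ Precedes (pre ++ X ∷ post) Y X →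
           ((∅ ∪ (_∈ pre)) ∪ (_≡ X)) Y
    from u (inj₁ Y≡X) = inj₂ Y≡X
    from u (inj₂ p) with precedes-++⁻ pre p
    ... | inj₁ q                = ⊥-elim (precedes-irrefl u (precedes-++⁺ pre (precedes-∈ʳ q) (here refl)))
    ... | inj₂ (inj₁ (Y∈pre , _)) = inj₁ (inj₂ Y∈pre)
    ... | inj₂ (inj₂ (here X∈post)) = ⊥-elim (precedes-irrefl u (precedes-++⁺ʳ pre (here X∈post)))
    ... | inj₂ (inj₂ (there q))     = ⊥-elim (precedes-irrefl u (precedes-++⁺ʳ pre (here (precedes-∈ʳ q))))

module MaximalChain {n k : ℕ} (1≤k : 1 ≤ k) {J : SubPred} {ρF : List Sub}
                    (chain : MaxChainOrder n k J ρF) where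

  open FlipChains n k J

  private
    r₀ = proj₁ chain
    rₘ = proj₁ (proj₂ chain)
    adm₀ = proj₁ (proj₂ (proj₂ chain))
    Inv₀ = proj₁ (proj₂ (proj₂ (proj₂ chain)))
    Invₘ = proj₁ (proj₂ (proj₂ (proj₂ (proj₂ chain))))
    steps = proj₂ (proj₂ (proj₂ (proj₂ (proj₂ chain))))

    oriented₀ : Oriented ∅ r₀
    oriented₀ = adm₀ , λ Y afY → (λ ()) , λ _ → lex Y afY (proj₂ (proj₂ (proj₂ adm₀)) Y afY)
      where
      lex : ∀ Y → AF n k J Y → Lex r₀ Y ⊎ Antilex r₀ Y → Lex r₀ Y
      lex Y afY (inj₁ l) = l
      lex Y afY (inj₂ a) = ⊥-elim (As-AF-disjoint (proj₁ (Inv₀ Y) (inj₂ (afY , a))) afY)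

  ρF-unique : Unique ρF
  ρF-unique = proj₁ (proj₂ (flipSteps-oriented oriented₀ steps))

  ρF⊆JF : ∀ {X} → X ∈ ρF → AF n k J X
  ρF⊆JF = All.lookup (flipSteps-AF steps)

  JF⊆ρF : ∀ {X} → AF n k J X → X ∈ ρF
  JF⊆ρF {X} afX with X ∈? ρF
  ... | yes X∈ = X∈
  ... | no X∉ with proj₂ (Invₘ X) (inj₂ afX)
  ...   | inj₁ asX = ⊥-elim (As-AF-disjoint asX afX)
  ...   | inj₂ (_ , antilex) =
    let admₘ , orₘ = proj₂ (proj₂ (flipSteps-oriented oriented₀ steps))
    in ⊥-elim (lex-antilex-exclusive 1≤k afX (admissible-unique admₘ) (proj₂ (orₘ X afX) [ (λ ()) , X∉ ]′)
                                      antilex)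

  state-at : ∀ {X} → X ∈ ρF → ∃[ r ] (Adm r ×
    (∀ {Y} → AF n k J Y → Y ≡ X ⊎ Precedes ρF Y X → Antilex r Y) ×
    (∀ {Y} → AF n k J Y → Precedes ρF X Y → Lex r Y))
  state-at X∈ =
    let r , adm , or = oriented-after oriented₀ steps X∈
    in r , adm , (λ afY → proj₁ (or _ afY)) , λ afY X≺Y → proj₂ (or _ afY) (not-yet X≺Y)
    where
    not-yet : ∀ {X Y} → Precedes ρF X Y → ¬ (Y ≡ X ⊎ Precedes ρF Y X)
    not-yet X≺Y (inj₁ refl) = precedes-irrefl ρF-unique X≺Y
    not-yet X≺Y (inj₂ Y≺X)  = precedes-asym ρF-unique X≺Y Y≺X

  ρF-precedes : ∀ {u w} → AF n k J u → AF n k J w → u ≢ w →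
                (∀ r → Adm r → Lex r u → ¬ Antilex r w) → Precedes ρF u w
  ρF-precedes afu afw u≢w never with precedes-total (JF⊆ρF afu) (JF⊆ρF afw) u≢w
  ... | inj₁ u≺w = u≺w
  ... | inj₂ w≺u = let r , adm , antilex , lex = state-at (JF⊆ρF afw)
                   in ⊥-elim (never r adm (lex afu w≺u) (antilex afw (inj₁ refl)))

  ρF-monotone : ∀ {u v w} → AF n k J u → AF n k J v → AF n k J w → u ≢ v → v ≢ w → u ≢ w →
    (∀ r → Adm r → Antilex r u → Lex r v → ¬ Antilex r w) →
    (∀ r → Adm r → Lex r u → Antilex r v → ¬ Lex r w) →
    (Precedes ρF u v × Precedes ρF v w) ⊎ (Precedes ρF w v × Precedes ρF v u)
  ρF-monotone {u} {v} {w} afu afv afw u≢v v≢w u≢w never-ALA never-LAL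
    with precedes-total (JF⊆ρF afu) (JF⊆ρF afv) u≢v | precedes-total (JF⊆ρF afv) (JF⊆ρF afw) v≢w
  ... | inj₁ u≺v | inj₁ v≺w = inj₁ (u≺v , v≺w)
  ... | inj₂ v≺u | inj₂ w≺v = inj₂ (w≺v , v≺u)
  ... | inj₂ v≺u | inj₁ v≺w =
    let r , adm , antilex , lex = state-at (JF⊆ρF afv)
    in ⊥-elim (never-LAL r adm (lex afu v≺u) (antilex afv (inj₁ refl)) (lex afw v≺w))
  ... | inj₁ u≺v | inj₂ w≺v with precedes-total (JF⊆ρF afu) (JF⊆ρF afw) u≢w
  ...   | inj₁ u≺w =
    let r , adm , antilex , lex = state-at (JF⊆ρF afw)
    in ⊥-elim (never-ALA r adm (antilex afu (inj₂ u≺w)) (lex afv w≺v) (antilex afw (inj₁ refl)))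
  ...   | inj₂ w≺u =
    let r , adm , antilex , lex = state-at (JF⊆ρF afu)
    in ⊥-elim (never-ALA r adm (antilex afu (inj₁ refl)) (lex afv u≺v) (antilex afw (inj₂ w≺u)))

record Extremes (Z : List ℕ) : Set where
  field
    bottom top : ℕ
    bottom∈   : bottom ∈ Z
    top∈      : top ∈ Z
    bottom≤   : ∀ {y} → y ∈ Z → bottom ≤ y
    ≤top      : ∀ {y} → y ∈ Z → y ≤ top
    bottom<top : bottom < top

  <top : ∀ {y} → y ∈ Z → y ≢ top → y < top
  <top y∈ y≢top = ≤∧≢⇒< (≤top y∈) y≢top

  bottom< : ∀ {y} → y ∈ Z → y ≢ bottom → bottom < y
  bottom< y∈ y≢bottom = ≤∧≢⇒< (bottom≤ y∈) (y≢bottom ∘ sym)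

maximum : ∀ x xs → ∃[ t ] (t ∈ x ∷ xs × (∀ {y} → y ∈ x ∷ xs → y ≤ t))
maximum x [] = x , here refl , λ { (here refl) → ≤-refl }
maximum x (x′ ∷ xs) with t , t∈ , ≤t ← maximum x′ xs with x ≤? t
... | yes x≤t = t , there t∈ , λ { (here refl) → x≤t ; (there y∈) → ≤t y∈ }
... | no x≰t  = x , here refl , λ { (here refl) → ≤-refl ; (there y∈) → <⇒≤ (≤-<-trans (≤t y∈) (≰⇒> x≰t)) }

extremes : ∀ {n k} Z → CS n (suc (suc k)) Z → Extremes Z
extremes (x ∷ x′ ∷ xs) (s , _) with t , t∈ , ≤t ← maximum x (x′ ∷ xs) = record
  { bottom = x ; top = t ; bottom∈ = here refl ; top∈ = t∈
  ; bottom≤ = λ { (here refl) → ≤-refl ; (there y∈) → <⇒≤ (sorted-head< s y∈) }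
  ; ≤top = ≤t ; bottom<top = <-≤-trans (sorted-head< s (here refl)) (≤t (there (here refl))) }

all-or-witness : ∀ {A : Set} {P Q : A → Set} xs → (∀ {x} → x ∈ xs → P x ⊎ Q x) →
                 (∀ {x} → x ∈ xs → P x) ⊎ ∃[ x ] (x ∈ xs × Q x)
all-or-witness []       _   = inj₁ λ ()
all-or-witness (x ∷ xs) pq with pq (here refl) | all-or-witness xs (pq ∘ there)
... | inj₂ qx | _                  = inj₂ (x , here refl , qx)
... | inj₁ _  | inj₂ (y , y∈ , qy) = inj₂ (y , there y∈ , qy)
... | inj₁ px | inj₁ ps            = inj₁ λ { (here refl) → px ; (there y∈) → ps y∈ }

module _ {Z : List ℕ} (ext : Extremes Z) where

  open Extremes ext

  increasing-from-triples : (R : ℕ → ℕ → Set) → (∀ {a b} → R a b → ¬ R b a) →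
    (∀ {a b c} → R a b → R b c → R a c) → R bottom top →
    (∀ {a b c} → a ∈ Z → b ∈ Z → c ∈ Z → a < b → b < c → (R a b × R b c) ⊎ (R c b × R b a)) →
    ∀ {w y} → w ∈ Z → y ∈ Z → w < y → R w y
  increasing-from-triples R asym trans Rbt triples {w} {y} w∈ y∈ w<y with w ≟ bottom | y ≟ top
  ... | yes refl | yes refl = Rbt
  ... | yes refl | no y≢top with triples bottom∈ y∈ top∈ w<y (<top y∈ y≢top)
  ...   | inj₁ (Rwy , _)   = Rwy
  ...   | inj₂ (Rty , Ryw) = ⊥-elim (asym Rbt (trans Rty Ryw))
  increasing-from-triples R asym trans Rbt triples {w} {y} w∈ y∈ w<y | no w≢bot | yes refl
    with triples bottom∈ w∈ top∈ (bottom< w∈ w≢bot) w<y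
  ... | inj₁ (_ , Rwy)   = Rwy
  ... | inj₂ (Ryw , Rwb) = ⊥-elim (asym Rbt (trans Ryw Rwb))
  increasing-from-triples R asym trans Rbt triples {w} {y} w∈ y∈ w<y | no w≢bot | no y≢top
    with triples bottom∈ w∈ top∈ (bottom< w∈ w≢bot) (<-≤-trans w<y (≤top y∈))
  ... | inj₂ (Rtw , Rwb) = ⊥-elim (asym Rbt (trans Rtw Rwb))
  ... | inj₁ (Rbw , _) with triples bottom∈ w∈ y∈ (bottom< w∈ w≢bot) w<y
  ...   | inj₁ (_ , Rwy) = Rwy
  ...   | inj₂ (_ , Rwb) = ⊥-elim (asym Rbw Rwb)

module AroundPacket {n k : ℕ} (J : List Sub) (realizable : Realizable n k (Mem J))
                    (Z : Sub) (csZ : CS n (suc (suc k)) Z) where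

  Js JF U : SubPred
  Js = As n k (Mem J)
  JF = AF n k (Mem J)
  U  = Js ∪ JF

  open FlipChains n k (Mem J) using (Lex; Antilex)

  X : ℕ → Sub
  X v = delete v Z

  E : ℕ → ℕ → Sub
  E u v = delete u (X v)

  open Extremes (extremes Z csZ) public

  X∈P : ∀ {v} → v ∈ Z → InP n (suc k) Z (X v)
  X∈P = delete∈packet csZ

  csX : ∀ {v} → v ∈ Z → CS n (suc k) (X v)
  csX = proj₁ ∘ X∈P

  E∈P : ∀ {u v} → u ∈ Z → v ∈ Z → u ≢ v → InP n k (X v) (E u v)
  E∈P u∈ v∈ u≢v = delete∈packet (csX v∈) (∈-delete⁺ Z u∈ u≢v)

  P⇒X : ∀ {Y} → InP n (suc k) Z Y → ∃[ v ] (v ∈ Z × Y ≡ X v)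
  P⇒X = packet⇒delete csZ

  P⇒E : ∀ {v Y} → v ∈ Z → InP n k (X v) Y → ∃[ u ] (u ∈ Z × u ≢ v × Y ≡ E u v)
  P⇒E v∈ Y∈ with u , u∈ , refl ← packet⇒delete (csX v∈) Y∈ =
    let u∈Z , u≢v = ∈-delete⁻ Z u∈ in u , u∈Z , u≢v , refl

  E-comm : ∀ u v → E u v ≡ E v u
  E-comm u v = delete-comm u v Z

  X-<lex : ∀ {u w} → u ∈ Z → w ∈ Z → w < u → X u <lex X w
  X-<lex = delete-<lex Z (proj₁ csZ)

  X-<lex⁻ : ∀ {u w} → u ∈ Z → w ∈ Z → X u <lex X w → w < u
  X-<lex⁻ {u} {w} u∈ w∈ Xu<Xw with <-cmp u w
  ... | tri< u<w _ _ = ⊥-elim (<lex-asym Xu<Xw (X-<lex w∈ u∈ u<w))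
  ... | tri≈ _ refl _ = ⊥-elim (<lex-irrefl Xu<Xw)
  ... | tri> _ _ w<u = w<u

  E-<lex : ∀ {u w v} → u ∈ Z → w ∈ Z → v ∈ Z → u ≢ v → w ≢ v → w < u → E u v <lex E w v
  E-<lex u∈ w∈ v∈ u≢v w≢v = delete-<lex _ (proj₁ (csX v∈)) (∈-delete⁺ Z u∈ u≢v) (∈-delete⁺ Z w∈ w≢v)

  full⇒E∈J : ∀ {u v} → u ∈ Z → v ∈ Z → u ≢ v → JF (X v) → E u v ∈ J
  full⇒E∈J u∈ v∈ u≢v (_ , full) = full _ (E∈P u∈ v∈ u≢v)

  E∈J-comm : ∀ {u v} → E u v ∈ J → E v u ∈ J
  E∈J-comm {u} {v} = subst (_∈ J) (E-comm u v)

  full⇒E′∈J : ∀ {u v} → u ∈ Z → v ∈ Z → u ≢ v → JF (X v) → E v u ∈ J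
  full⇒E′∈J u∈ v∈ u≢v = E∈J-comm ∘ full⇒E∈J u∈ v∈ u≢v

  -- E top b is the lexicographically least member of the packet of X b,
  -- and a proper suffix never contains the least member.
  Js-misses-E-top : ∀ {b} → b ∈ Z → b ≢ top → Js (X b) → E top b ∉ J
  Js-misses-E-top b∈ b≢top (_ , _ , (Y , Y∈ , Y∉J) , suffix) Etop∈J
    with c , c∈ , c≢b , refl ← P⇒E b∈ Y∈ with c ≟ top
  ... | yes refl = Y∉J Etop∈J
  ... | no c≢top = Y∉J (suffix (E top _) (E c _) (E∈P top∈ b∈ (b≢top ∘ sym)) (E∈P c∈ b∈ c≢b)
                               (E-<lex top∈ c∈ b∈ (b≢top ∘ sym) c≢b (<top c∈ c≢top)) Etop∈J)

  private
    E∈J? : ∀ v w → Dec (w ≡ v ⊎ E w v ∈ J)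
    E∈J? v w = (w ≟ v) ⊎-dec (E w v ∈? J)

  outside-U⇒Jp : ∀ {u v} → v ∈ Z → ¬ U (X v) → u ∈ Z → u ≢ v → E u v ∈ J → Ap n k (Mem J) (X v)
  outside-U⇒Jp {u} {v} v∈ X∉U u∈ u≢v Euv∈J with all? (E∈J? v) Z
  ... | yes all = ⊥-elim (X∉U (inj₂ (csX v∈ , full)))
    where
    full : ∀ Y → InP n k (X v) Y → Y ∈ J
    full Y Y∈ with w , w∈ , w≢v , refl ← P⇒E v∈ Y∈ with All.lookup all w∈
    ... | inj₁ w≡v = ⊥-elim (w≢v w≡v)
    ... | inj₂ E∈J = E∈J
  ... | no ¬all with w , w∈ , Ewv∉J ← find (¬All⇒Any¬ (E∈J? v) Z ¬all) =
    classify (realizable (X v) (csX v∈))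
      (E u v , E∈P u∈ v∈ u≢v , Euv∈J) (E w v , E∈P w∈ v∈ (Ewv∉J ∘ inj₁) , Ewv∉J ∘ inj₂)
    where
    classify : PrefixIn n k (Mem J) (X v) ⊎ SuffixIn n k (Mem J) (X v) →
               NonEmptyIn n k (Mem J) (X v) → NotFullIn n k (Mem J) (X v) → Ap n k (Mem J) (X v)
    classify (inj₁ prefix) nonEmpty notFull = csX v∈ , nonEmpty , notFull , prefix
    classify (inj₂ suffix) nonEmpty notFull = ⊥-elim (X∉U (inj₁ (csX v∈ , nonEmpty , notFull , suffix)))

  JF-below-Js : U (X top) → ∀ {a b} → a ∈ Z → b ∈ Z → JF (X a) → Js (X b) → a < b
  JF-below-Js Utop {a} {b} a∈ b∈ fa sb with <-cmp a b
  ... | tri< a<b _ _  = a<b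
  ... | tri≈ _ refl _ = ⊥-elim (As-AF-disjoint sb fa)
  ... | tri> _ _ b<a  = ⊥-elim (contra Utop)
    where
    b≢top : b ≢ top
    b≢top b≡top = <-irrefl b≡top (<-≤-trans b<a (≤top a∈))
    a≢top : a ≢ top
    a≢top refl = Js-misses-E-top b∈ b≢top sb (full⇒E′∈J b∈ a∈ (<⇒≢ b<a) fa)
    contra : ¬ U (X top)
    contra (inj₂ ftop) = Js-misses-E-top b∈ b≢top sb (full⇒E′∈J b∈ top∈ b≢top ftop)
    contra (inj₁ (_ , _ , _ , suffix)) = Js-misses-E-top b∈ b≢top sb (subst (_∈ J) (E-comm b top)
      (suffix (E a top) (E b top) (E∈P a∈ top∈ a≢top) (E∈P b∈ top∈ b≢top)
              (E-<lex a∈ b∈ top∈ a≢top b≢top b<a) (full⇒E′∈J top∈ a∈ (a≢top ∘ sym) fa)))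

  Js-below-JF : ¬ U (X top) → ∀ {a b} → a ∈ Z → b ∈ Z → JF (X a) → Js (X b) → b < a
  Js-below-JF X∉U {a} {b} a∈ b∈ fa sb with <-cmp a b
  ... | tri> _ _ b<a  = b<a
  ... | tri≈ _ refl _ = ⊥-elim (As-AF-disjoint sb fa)
  ... | tri< a<b _ _  = ⊥-elim (Js-misses-E-top b∈ b≢top sb (subst (_∈ J) (E-comm b top)
      (prefix (E a top) (E b top) (E∈P a∈ top∈ a≢top) (E∈P b∈ top∈ b≢top)
              (E-<lex b∈ a∈ top∈ b≢top a≢top a<b) Eatop∈J)))
    where
    a≢top : a ≢ top
    a≢top refl = X∉U (inj₂ fa)
    b≢top : b ≢ top
    b≢top refl = X∉U (inj₁ sb)
    Eatop∈J = full⇒E′∈J top∈ a∈ (a≢top ∘ sym) fa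
    prefix = proj₂ (proj₂ (proj₂ (outside-U⇒Jp top∈ X∉U a∈ a≢top Eatop∈J)))

  private
    lex-pair : ∀ {r u w v} → Lex r (X v) → u ∈ Z → w ∈ Z → v ∈ Z → u ≢ v → w ≢ v → w < u →
               E u v ∈ J → E w v ∈ J → Precedes r (E u v) (E w v)
    lex-pair lex u∈ w∈ v∈ u≢v w≢v w<u Eu∈J Ew∈J = before⇒precedes
      (lex _ _ (E∈P u∈ v∈ u≢v) Eu∈J (E∈P w∈ v∈ w≢v) Ew∈J (E-<lex u∈ w∈ v∈ u≢v w≢v w<u))

    antilex-pair : ∀ {r u w v} → Antilex r (X v) → u ∈ Z → w ∈ Z → v ∈ Z → u ≢ v → w ≢ v → w < u →
                   E u v ∈ J → E w v ∈ J → Precedes r (E w v) (E u v)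
    antilex-pair antilex u∈ w∈ v∈ u≢v w≢v w<u Eu∈J Ew∈J = before⇒precedes
      (antilex _ _ (E∈P u∈ v∈ u≢v) Eu∈J (E∈P w∈ v∈ w≢v) Ew∈J (E-<lex u∈ w∈ v∈ u≢v w≢v w<u))

  -- Each of E a b, E a c, E b c lies in two of the three packets; these orientations order them cyclically.
  no-lex-antilex-lex : ∀ {r a b c} → Unique r → a ∈ Z → b ∈ Z → c ∈ Z → a < b → b < c →
    E a b ∈ J → E a c ∈ J → E b c ∈ J → Lex r (X a) → Antilex r (X b) → ¬ Lex r (X c)
  no-lex-antilex-lex {r} {a} {b} {c} u a∈ b∈ c∈ a<b b<c Eab Eac Ebc lexa antilexb lexc =
    precedes-cycle u
      (lex-pair lexa c∈ b∈ a∈ (>⇒≢ a<c) (>⇒≢ a<b) b<c (E∈J-comm Eac) (E∈J-comm Eab))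
      (subst₂ (Precedes r) (E-comm a b) (E-comm c b)
        (antilex-pair antilexb c∈ a∈ b∈ (>⇒≢ b<c) (<⇒≢ a<b) a<c (E∈J-comm Ebc) Eab))
      (subst (Precedes r (E b c)) (E-comm a c)
        (lex-pair lexc b∈ a∈ c∈ (<⇒≢ b<c) (<⇒≢ a<c) a<b Ebc Eac))
    where
    a<c = <-trans a<b b<c

  no-antilex-lex-antilex : ∀ {r a b c} → Unique r → a ∈ Z → b ∈ Z → c ∈ Z → a < b → b < c →
    E a b ∈ J → E a c ∈ J → E b c ∈ J → Antilex r (X a) → Lex r (X b) → ¬ Antilex r (X c)
  no-antilex-lex-antilex {r} {a} {b} {c} u a∈ b∈ c∈ a<b b<c Eab Eac Ebc antilexa lexb antilexc =
    precedes-cycle u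
      (subst (Precedes r (E b a)) (E-comm c a)
        (antilex-pair antilexa c∈ b∈ a∈ (>⇒≢ a<c) (>⇒≢ a<b) b<c (E∈J-comm Eac) (E∈J-comm Eab)))
      (antilex-pair antilexc b∈ a∈ c∈ (<⇒≢ b<c) (<⇒≢ a<c) a<b Ebc Eac)
      (subst₂ (Precedes r) (E-comm c b) (E-comm a b)
        (lex-pair lexb c∈ a∈ b∈ (>⇒≢ b<c) (<⇒≢ a<b) a<c (E∈J-comm Ebc) Eab))
    where
    a<c = <-trans a<b b<c

  lex-from-indices : ∀ {A L} →
    (∀ {y w} → y ∈ Z → w ∈ Z → w < y → A (X y) → A (X w) → Precedes L (X y) (X w)) →
    InducesLex n (suc k) A L Z
  lex-from-indices order Y W Y∈ aY W∈ aW Y<W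
    with y , y∈ , refl ← P⇒X Y∈ | w , w∈ , refl ← P⇒X W∈ =
    precedes⇒before (order y∈ w∈ (X-<lex⁻ y∈ w∈ Y<W) aY aW)

  antilex-from-indices : ∀ {A L} →
    (∀ {y w} → y ∈ Z → w ∈ Z → w < y → A (X y) → A (X w) → Precedes L (X w) (X y)) →
    InducesAntilex n (suc k) A L Z
  antilex-from-indices order Y W Y∈ aY W∈ aW Y<W
    with y , y∈ , refl ← P⇒X Y∈ | w , w∈ , refl ← P⇒X W∈ =
    precedes⇒before (order y∈ w∈ (X-<lex⁻ y∈ w∈ Y<W) aY aW)

  proper-suffix-misses-X-top : ∀ {A} → NotFullIn n (suc k) A Z → SuffixIn n (suc k) A Z → ¬ A (X top)
  proper-suffix-misses-X-top (W , W∈ , W∉A) suffix Xtop∈A with c , c∈ , refl ← P⇒X W∈ with c ≟ top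
  ... | yes refl  = W∉A Xtop∈A
  ... | no c≢top = W∉A (suffix (X top) (X c) (X∈P top∈) (X∈P c∈) (X-<lex top∈ c∈ (<top c∈ c≢top)) Xtop∈A)

  nonempty-prefix-has-X-top : ∀ {A} → NonEmptyIn n (suc k) A Z → PrefixIn n (suc k) A Z → A (X top)
  nonempty-prefix-has-X-top (Y , Y∈ , Y∈A) prefix with c , c∈ , refl ← P⇒X Y∈ with c ≟ top
  ... | yes refl  = Y∈A
  ... | no c≢top = prefix (X c) (X top) (X∈P c∈) (X∈P top∈) (X-<lex top∈ c∈ (<top c∈ c≢top)) Y∈A

  proper-prefix-misses-X-bottom : ∀ {A} → NotFullIn n (suc k) A Z → PrefixIn n (suc k) A Z → ¬ A (X bottom)
  proper-prefix-misses-X-bottom (W , W∈ , W∉A) prefix Xbot∈A with c , c∈ , refl ← P⇒X W∈ with c ≟ bottom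
  ... | yes refl     = W∉A Xbot∈A
  ... | no c≢bottom = W∉A (prefix (X bottom) (X c) (X∈P bottom∈) (X∈P c∈)
                                  (X-<lex c∈ bottom∈ (bottom< c∈ c≢bottom)) Xbot∈A)

  Js-suffix : ¬ U (X top) → SuffixIn n (suc k) U Z → SuffixIn n (suc k) Js Z
  Js-suffix Xtop∉U suffix A B A∈ B∈ A<B sA with suffix A B A∈ B∈ A<B (inj₁ sA)
  ... | inj₁ sB = sB
  ... | inj₂ fB with a , a∈ , refl ← P⇒X A∈ | b , b∈ , refl ← P⇒X B∈ =
    ⊥-elim (<-asym (X-<lex⁻ a∈ b∈ A<B) (Js-below-JF Xtop∉U b∈ a∈ fB sA))

  Js-prefix : U (X top) → PrefixIn n (suc k) U Z → PrefixIn n (suc k) Js Z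
  Js-prefix Xtop∈U prefix A B A∈ B∈ B<A sA with prefix A B A∈ B∈ B<A (inj₁ sA)
  ... | inj₁ sB = sB
  ... | inj₂ fB with a , a∈ , refl ← P⇒X A∈ | b , b∈ , refl ← P⇒X B∈ =
    ⊥-elim (<-asym (X-<lex⁻ b∈ a∈ B<A) (JF-below-Js Xtop∈U b∈ a∈ fB sA))

module Concatenation {n k : ℕ} (1≤k : 1 ≤ k) (J : List Sub) (realizable : Realizable n k (Mem J))
                     {ρs ρF : List Sub} (admissibleS : Admissible n (suc k) (As n k (Mem J)) ρs)
                     (chain : MaxChainOrder n k (Mem J) ρF) where

  open FlipChains n k (Mem J) using (Lex; Antilex; Adm; admissible-unique)
  open MaximalChain 1≤k chain

  Js JF U : SubPred
  Js = As n k (Mem J)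
  JF = AF n k (Mem J)
  U  = Js ∪ JF

  ρ : List Sub
  ρ = ρs ++ ρF

  private
    ρs-unique : Unique ρs
    ρs-unique = proj₁ (proj₁ admissibleS)

    ρs≐Js : ∀ Y → (Y ∈ ρs → Js Y) × (Js Y → Y ∈ ρs)
    ρs≐Js = proj₂ (proj₁ admissibleS)

    Jp⇒lex : ∀ {r Y} → Adm r → Ap n k (Mem J) Y → Lex r Y
    Jp⇒lex adm = proj₁ (proj₂ (proj₂ adm)) _

    Js⇒antilex : ∀ {r Y} → Adm r → Js Y → Antilex r Y
    Js⇒antilex adm = proj₁ (proj₂ adm) _

  ρ-total : TotalOrderOn U ρ
  ρ-total = Unique.++⁺ ρs-unique ρF-unique (λ (∈s , ∈F) → As-AF-disjoint (proj₁ (ρs≐Js _) ∈s) (ρF⊆JF ∈F)) ,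
            λ Y → [ inj₁ ∘ proj₁ (ρs≐Js Y) , inj₂ ∘ ρF⊆JF ]′ ∘ ∈-++⁻ ρs ,
                  [ ∈-++⁺ˡ ∘ proj₂ (ρs≐Js Y) , ∈-++⁺ʳ ρs ∘ JF⊆ρF ]′

  Js-before-JF : ∀ {s f} → Js s → JF f → Precedes ρ s f
  Js-before-JF s∈ f∈ = precedes-++⁺ ρs (proj₂ (ρs≐Js _) s∈) (JF⊆ρF f∈)

  module _ (Z : Sub) (csZ : CS n (suc (suc k)) Z) where

    open AroundPacket J realizable Z csZ hiding (Js; JF; U)

    private
      X-distinct : ∀ {a b} → a ∈ Z → b ∈ Z → a < b → X a ≢ X b
      X-distinct a∈ b∈ a<b = <lex⇒≢ (X-<lex b∈ a∈ a<b) ∘ sym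

    JF-pair-below-Jp : ∀ {a b c} → a ∈ Z → b ∈ Z → c ∈ Z → a < b → b < c →
      JF (X a) → JF (X b) → Ap n k (Mem J) (X c) → Precedes ρF (X a) (X b)
    JF-pair-below-Jp a∈ b∈ c∈ a<b b<c fa fb pc = ρF-precedes fa fb (X-distinct a∈ b∈ a<b) λ r adm lexa antilexb →
      no-lex-antilex-lex (admissible-unique adm) a∈ b∈ c∈ a<b b<c
        (full⇒E∈J a∈ b∈ (<⇒≢ a<b) fb) (full⇒E′∈J c∈ a∈ (>⇒≢ (<-trans a<b b<c)) fa) (full⇒E′∈J c∈ b∈ (>⇒≢ b<c) fb)
        lexa antilexb (Jp⇒lex adm pc)

    JF-pair-above-Jp : ∀ {a b c} → a ∈ Z → b ∈ Z → c ∈ Z → a < b → b < c →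
      Ap n k (Mem J) (X a) → JF (X b) → JF (X c) → Precedes ρF (X c) (X b)
    JF-pair-above-Jp a∈ b∈ c∈ a<b b<c pa fb fc = ρF-precedes fc fb (X-distinct b∈ c∈ b<c ∘ sym) λ r adm lexc antilexb →
      no-lex-antilex-lex (admissible-unique adm) a∈ b∈ c∈ a<b b<c
        (full⇒E∈J a∈ b∈ (<⇒≢ a<b) fb) (full⇒E∈J a∈ c∈ (<⇒≢ (<-trans a<b b<c)) fc) (full⇒E∈J b∈ c∈ (<⇒≢ b<c) fc)
        (Jp⇒lex adm pa) antilexb lexc

    JF-pair-below-Js : ∀ {a b c} → a ∈ Z → b ∈ Z → c ∈ Z → a < b → b < c →
      JF (X a) → JF (X b) → Js (X c) → Precedes ρF (X b) (X a)
    JF-pair-below-Js a∈ b∈ c∈ a<b b<c fa fb sc = ρF-precedes fb fa (X-distinct a∈ b∈ a<b ∘ sym) λ r adm lexb antilexa →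
      no-antilex-lex-antilex (admissible-unique adm) a∈ b∈ c∈ a<b b<c
        (full⇒E∈J a∈ b∈ (<⇒≢ a<b) fb) (full⇒E′∈J c∈ a∈ (>⇒≢ (<-trans a<b b<c)) fa) (full⇒E′∈J c∈ b∈ (>⇒≢ b<c) fb)
        antilexa lexb (Js⇒antilex adm sc)

    JF-triple-monotone : ∀ {a b c} → a ∈ Z → b ∈ Z → c ∈ Z → a < b → b < c →
      JF (X a) → JF (X b) → JF (X c) →
      (Precedes ρF (X a) (X b) × Precedes ρF (X b) (X c)) ⊎ (Precedes ρF (X c) (X b) × Precedes ρF (X b) (X a))
    JF-triple-monotone a∈ b∈ c∈ a<b b<c fa fb fc =
      ρF-monotone fa fb fc (X-distinct a∈ b∈ a<b) (X-distinct b∈ c∈ b<c) (X-distinct a∈ c∈ a<c)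
        (λ r adm → no-antilex-lex-antilex (admissible-unique adm) a∈ b∈ c∈ a<b b<c Eab Eac Ebc)
        (λ r adm → no-lex-antilex-lex (admissible-unique adm) a∈ b∈ c∈ a<b b<c Eab Eac Ebc)
      where
      a<c = <-trans a<b b<c
      Eab = full⇒E∈J a∈ b∈ (<⇒≢ a<b) fb
      Eac = full⇒E∈J a∈ c∈ (<⇒≢ a<c) fc
      Ebc = full⇒E∈J b∈ c∈ (<⇒≢ b<c) fc

    private
      lex-ρs⇒ρ : InducesLex n (suc k) Js ρs Z → ∀ {y w} → y ∈ Z → w ∈ Z → w < y →
                 Js (X y) → Js (X w) → Precedes ρ (X y) (X w)
      lex-ρs⇒ρ lex y∈ w∈ w<y sy sw =
        precedes-++⁺ˡ ρF (before⇒precedes (lex _ _ (X∈P y∈) sy (X∈P w∈) sw (X-<lex y∈ w∈ w<y)))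

      antilex-ρs⇒ρ : InducesAntilex n (suc k) Js ρs Z → ∀ {y w} → y ∈ Z → w ∈ Z → w < y →
                     Js (X y) → Js (X w) → Precedes ρ (X w) (X y)
      antilex-ρs⇒ρ antilex y∈ w∈ w<y sy sw =
        precedes-++⁺ˡ ρF (before⇒precedes (antilex _ _ (X∈P y∈) sy (X∈P w∈) sw (X-<lex y∈ w∈ w<y)))

    ρ-antilex-on-Us : As n (suc k) U Z → InducesAntilex n (suc k) U ρ Z
    ρ-antilex-on-Us (_ , _ , notFull@(W , W∈ , W∉U) , suffix) = antilex-from-indices order
      where
      Xtop∉U = proper-suffix-misses-X-top notFull suffix
      order : ∀ {y w} → y ∈ Z → w ∈ Z → w < y → U (X y) → U (X w) → Precedes ρ (X w) (X y)
      order y∈ w∈ w<y (inj₁ sy) (inj₁ sw) = antilex-ρs⇒ρ (proj₁ (proj₂ admissibleS) Z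
        (csZ , (X _ , X∈P y∈ , sy) , (W , W∈ , W∉U ∘ inj₁) , Js-suffix Xtop∉U suffix)) y∈ w∈ w<y sy sw
      order y∈ w∈ w<y (inj₁ sy) (inj₂ fw) = ⊥-elim (<-asym w<y (Js-below-JF Xtop∉U w∈ y∈ fw sy))
      order y∈ w∈ w<y (inj₂ fy) (inj₁ sw) = Js-before-JF sw fy
      order {y} y∈ w∈ w<y (inj₂ fy) (inj₂ fw) =
        precedes-++⁺ʳ ρs (JF-pair-below-Jp w∈ y∈ top∈ w<y (<top y∈ y≢top) fw fy Xtop∈Jp)
        where
        y≢top : y ≢ top
        y≢top refl = Xtop∉U (inj₂ fy)
        Xtop∈Jp = outside-U⇒Jp top∈ Xtop∉U y∈ y≢top (full⇒E′∈J top∈ y∈ (y≢top ∘ sym) fy)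

    ρ-lex-on-Up : Ap n (suc k) U Z → InducesLex n (suc k) U ρ Z
    ρ-lex-on-Up (_ , nonEmpty , notFull@(W , W∈ , W∉U) , prefix) = lex-from-indices order
      where
      Xbottom∉U = proper-prefix-misses-X-bottom notFull prefix
      Xtop∈U    = nonempty-prefix-has-X-top nonEmpty prefix
      order : ∀ {y w} → y ∈ Z → w ∈ Z → w < y → U (X y) → U (X w) → Precedes ρ (X y) (X w)
      order y∈ w∈ w<y (inj₁ sy) (inj₁ sw) = lex-ρs⇒ρ (proj₁ (proj₂ (proj₂ admissibleS)) Z
        (csZ , (X _ , X∈P y∈ , sy) , (W , W∈ , W∉U ∘ inj₁) , Js-prefix Xtop∈U prefix)) y∈ w∈ w<y sy sw
      order y∈ w∈ w<y (inj₁ sy) (inj₂ fw) = Js-before-JF sy fw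
      order y∈ w∈ w<y (inj₂ fy) (inj₁ sw) = ⊥-elim (<-asym w<y (JF-below-Js Xtop∈U y∈ w∈ fy sw))
      order {w = w} y∈ w∈ w<y (inj₂ fy) (inj₂ fw) =
        precedes-++⁺ʳ ρs (JF-pair-above-Jp bottom∈ w∈ y∈ (bottom< w∈ w≢bottom) w<y Xbottom∈Jp fw fy)
        where
        w≢bottom : w ≢ bottom
        w≢bottom refl = Xbottom∉U (inj₂ fw)
        Xbottom∈Jp = outside-U⇒Jp bottom∈ Xbottom∉U w∈ w≢bottom (full⇒E′∈J bottom∈ w∈ (w≢bottom ∘ sym) fw)

    ρ-on-all-Js : (∀ {v} → v ∈ Z → Js (X v)) → InducesLex n (suc k) U ρ Z ⊎ InducesAntilex n (suc k) U ρ Z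
    ρ-on-all-Js allJs with proj₂ (proj₂ (proj₂ admissibleS)) Z (csZ , full)
      where
      full : ∀ Y → InP n (suc k) Z Y → Js Y
      full Y Y∈ with v , v∈ , refl ← P⇒X Y∈ = allJs v∈
    ... | inj₁ lex     = inj₁ (lex-from-indices λ y∈ w∈ w<y _ _ → lex-ρs⇒ρ lex y∈ w∈ w<y (allJs y∈) (allJs w∈))
    ... | inj₂ antilex =
      inj₂ (antilex-from-indices λ y∈ w∈ w<y _ _ → antilex-ρs⇒ρ antilex y∈ w∈ w<y (allJs y∈) (allJs w∈))

    ρ-on-mixed : (∀ {v} → v ∈ Z → U (X v)) → ∀ {c f} → c ∈ Z → f ∈ Z → Js (X c) → JF (X f) →
                 InducesLex n (suc k) U ρ Z
    ρ-on-mixed allU {c} c∈ f∈ sc ff = lex-from-indices order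
      where
      Xtop∈U = allU top∈
      Z∈Ap-Js : Ap n (suc k) Js Z
      Z∈Ap-Js = csZ , (X c , X∈P c∈ , sc) , (X _ , X∈P f∈ , λ sf → As-AF-disjoint sf ff) ,
              Js-prefix Xtop∈U (λ { _ B _ B∈ _ _ → let v , v∈ , B≡ = P⇒X B∈ in subst U (sym B≡) (allU v∈) })
      order : ∀ {y w} → y ∈ Z → w ∈ Z → w < y → U (X y) → U (X w) → Precedes ρ (X y) (X w)
      order y∈ w∈ w<y (inj₁ sy) (inj₁ sw) = lex-ρs⇒ρ (proj₁ (proj₂ (proj₂ admissibleS)) Z Z∈Ap-Js) y∈ w∈ w<y sy sw
      order y∈ w∈ w<y (inj₁ sy) (inj₂ fw) = Js-before-JF sy fw
      order y∈ w∈ w<y (inj₂ fy) (inj₁ sw) = ⊥-elim (<-asym w<y (JF-below-Js Xtop∈U y∈ w∈ fy sw))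
      order y∈ w∈ w<y (inj₂ fy) (inj₂ fw) =
        precedes-++⁺ʳ ρs (JF-pair-below-Js w∈ y∈ c∈ w<y (JF-below-Js Xtop∈U y∈ c∈ fy sc) fw fy sc)

    -- ρF is monotone along the packet, and the order of X bottom and X top in ρF decides the direction.
    ρ-on-all-JF : (∀ {v} → v ∈ Z → JF (X v)) → InducesLex n (suc k) U ρ Z ⊎ InducesAntilex n (suc k) U ρ Z
    ρ-on-all-JF allJF
      with precedes-total (JF⊆ρF (allJF bottom∈)) (JF⊆ρF (allJF top∈)) (X-distinct bottom∈ top∈ bottom<top)
    ... | inj₁ bottom≺top = inj₂ (antilex-from-indices λ y∈ w∈ w<y _ _ → precedes-++⁺ʳ ρs
            (increasing-from-triples (extremes Z csZ) (λ a b → Precedes ρF (X a) (X b))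
              (precedes-asym ρF-unique) (precedes-trans ρF-unique) bottom≺top triples w∈ y∈ w<y))
      where
      triples : ∀ {a b c} → a ∈ Z → b ∈ Z → c ∈ Z → a < b → b < c → _
      triples a∈ b∈ c∈ a<b b<c = JF-triple-monotone a∈ b∈ c∈ a<b b<c (allJF a∈) (allJF b∈) (allJF c∈)
    ... | inj₂ top≺bottom = inj₁ (lex-from-indices λ y∈ w∈ w<y _ _ → precedes-++⁺ʳ ρs
            (increasing-from-triples (extremes Z csZ) (λ a b → Precedes ρF (X b) (X a))
              (flip (precedes-asym ρF-unique)) (flip (precedes-trans ρF-unique)) top≺bottom triples w∈ y∈ w<y))
      where
      triples : ∀ {a b c} → a ∈ Z → b ∈ Z → c ∈ Z → a < b → b < c → _
      triples a∈ b∈ c∈ a<b b<c =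
        Sum.swap (Sum.map Prod.swap Prod.swap (JF-triple-monotone a∈ b∈ c∈ a<b b<c (allJF a∈) (allJF b∈) (allJF c∈)))

    ρ-on-UF : AF n (suc k) U Z → InducesLex n (suc k) U ρ Z ⊎ InducesAntilex n (suc k) U ρ Z
    ρ-on-UF (_ , full) = by-kinds (λ v∈ → full _ (X∈P v∈))
      where
      by-kinds : (∀ {v} → v ∈ Z → U (X v)) → InducesLex n (suc k) U ρ Z ⊎ InducesAntilex n (suc k) U ρ Z
      by-kinds allU with all-or-witness Z allU
      ... | inj₁ allJs = ρ-on-all-Js allJs
      ... | inj₂ (f , f∈ , ff) with all-or-witness Z (Sum.swap ∘ allU)
      ...   | inj₂ (c , c∈ , sc) = inj₁ (ρ-on-mixed allU c∈ f∈ sc ff)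
      ...   | inj₁ allJF         = ρ-on-all-JF allJF

lemma4p1 : (n k : ℕ) → 2 ≤ k → (J : List Sub) → All (CS n k) J →
    Realizable n k (Mem J) →
    (ρs ρF : List Sub) →
    Admissible n (suc k) (As n k (Mem J)) ρs →
    MaxChainOrder n k (Mem J) ρF →
    Admissible n (suc k) (As n k (Mem J) ∪ AF n k (Mem J)) (ρs ++ ρF)
    × (∀ s f → As n k (Mem J) s → AF n k (Mem J) f → Before (ρs ++ ρF) s f)
lemma4p1 n k 2≤k J _ realizable ρs ρF admissibleS chain =
  ( ρ-total
  , (λ Z Z∈Us → ρ-antilex-on-Us Z (proj₁ Z∈Us) Z∈Us)
  , (λ Z Z∈Up → ρ-lex-on-Up Z (proj₁ Z∈Up) Z∈Up)
  , (λ Z Z∈UF → ρ-on-UF Z (proj₁ Z∈UF) Z∈UF) )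
  , λ s f s∈Js f∈JF → precedes⇒before (Js-before-JF s∈Js f∈JF)
  where open Concatenation (≤-trans (n≤1+n 1) 2≤k) J realizable admissibleS chain
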